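{- Let $n$ be a positive integer. The graph $C_3 \times K_n$ admits a $C_4$-decomposition if and only if $n \equiv 0$ or $1 \pmod 4$.
   Context: $K_n$ is the complete graph on $n$ vertices, $C_k$ the cycle of length $k$. The tensor product $G \times H$ has vertex set $V(G)\times V(H)$, with $(g_1,h_1)$ adjacent to $(g_2,h_2)$ iff $g_1g_2 \in E(G)$ and $h_1h_2 \in E(H)$. A $C_k$-decomposition of a graph is a partition of its edge set into edge sets of subgraphs isomorphic to $C_k$. -}

module Defs where

open import Data.Nat using (ℕ; suc; _%_; NonZero)
open import Data.Fin using (Fin; toℕ)
open import Data.Product using (Σ; _×_; _,_)
open import Data.Sum using (_⊎_)
open import Data.List using (List; length; lookup)
open import Relation.Binary.PropositionalEquality using (_≡_; _≢_)

-- A (simple) graph: a vertex type and an adjacency relation.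
-- All graphs built below have symmetric, irreflexive adjacency.
record Graph : Set₁ where
  field
    V : Set
    Adj : V → V → Set
open Graph public

K : ℕ → Graph
K n = record { V = Fin n ; Adj = λ i j → i ≢ j }

C : (k : ℕ) → .{{_ : NonZero k}} → Graph
C k = record
  { V = Fin k
  ; Adj = λ i j → (toℕ j ≡ suc (toℕ i) % k) ⊎ (toℕ i ≡ suc (toℕ j) % k)
  }

_⊗_ : Graph → Graph → Graph
G ⊗ H = record
  { V = V G × V H
  ; Adj = λ { (g₁ , h₁) (g₂ , h₂) → Adj G g₁ g₂ × Adj H h₁ h₂ }
  }

record C4In (G : Graph) : Set where
  field
    v₀ v₁ v₂ v₃ : V G
    d01 : v₀ ≢ v₁
    d02 : v₀ ≢ v₂
    d03 : v₀ ≢ v₃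
    d12 : v₁ ≢ v₂
    d13 : v₁ ≢ v₃
    d23 : v₂ ≢ v₃
    e01 : Adj G v₀ v₁
    e12 : Adj G v₁ v₂
    e23 : Adj G v₂ v₃
    e30 : Adj G v₃ v₀
open C4In public

SameEdge : {A : Set} → A → A → A → A → Set
SameEdge u v a b = (u ≡ a × v ≡ b) ⊎ (u ≡ b × v ≡ a)

EdgeOf : {G : Graph} → V G → V G → C4In G → Set
EdgeOf u v c =
  SameEdge u v (v₀ c) (v₁ c) ⊎ SameEdge u v (v₁ c) (v₂ c) ⊎
  SameEdge u v (v₂ c) (v₃ c) ⊎ SameEdge u v (v₃ c) (v₀ c)

record C4Decomposition (G : Graph) : Set where
  field
    cycles : List (C4In G)
    exactlyOnce : ∀ u v → Adj G u v →
      Σ (Fin (length cycles)) λ i →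
        EdgeOf {G} u v (lookup cycles i) ×
        (∀ j → EdgeOf {G} u v (lookup cycles j) → j ≡ i)

-- Necessity is double counting: every edge of C₃ × K_n lies on exactly one
-- 4-cycle, so the 8 darts of each cycle partition the 6·n(n−1) darts of the
-- graph, and 8 ∣ 6·n(n−1) forces n ≡ 0, 1 (mod 4).
--
-- Sufficiency: K_n decomposes into paths x — y — z of length two when
-- n ≡ 0, 1 (mod 4) (add four vertices at a time: K₄ is three such paths, and
-- every old vertex x is the centre of the paths 0 — x — 1 and 2 — x — 3).
-- Each such path, placed in the three layers of C₃ × K_n, yields three 4-cycles
-- (m, x), (m+1, y), (m, z), (m−1, y) that together use each of the twelve
-- edges lying over the path exactly once.
module Submission where

open import Defs
open import Data.Empty using (⊥; ⊥-elim)
open import Data.Fin using (Fin; zero; suc; cast; punchIn; punchOut; _≟_)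
open import Data.Fin.Patterns using (0F; 1F; 2F; 3F)
open import Data.Fin.Properties
  using ( cantor-schröder-bernstein; cast-involutive; punchIn-injective; punchIn-punchOut
        ; punchInᵢ≢i; +↔⊎; *↔×; 0↔⊥)
open import Data.List using (List; length; lookup; tabulate)
open import Data.List.Properties using (length-tabulate)
open import Data.Nat using (ℕ; zero; suc; _+_; _*_; _%_; _/_; _≤_; s≤s; NonZero)
open import Data.Nat.Divisibility using (_∣_; divides; n∣m⇒m%n≡0)
open import Data.Nat.DivMod using (m≡m%n+[m/n]*n; m%n<n; [m+kn]%n≡m%n)
open import Data.Nat.Properties using (+-comm; suc-injective)
open import Data.Nat.Tactic.RingSolver using (solve-∀)
open import Data.Product using (Σ; ∃; _×_; _,_; proj₁; proj₂; uncurry)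
open import Data.Product.Function.NonDependent.Propositional using (_×-↔_)
open import Data.Product.Properties using (,-injectiveˡ; ,-injectiveʳ)
open import Data.Sum using (_⊎_; inj₁; inj₂) renaming (map to ⊎-map)
open import Data.Sum.Function.Propositional using (_⊎-↔_)
open import Data.Sum.Properties using (inj₁-injective; inj₂-injective)
open import Function using (_∘_; id; _↔_; Inverse; Injection; Equivalence; _⇔_; mk⇔)
open import Function.Definitions using (Injective)
open import Function.Properties.Inverse using (↔-refl; ↔-sym; ↔-trans; ↔⇒↣)
open import Relation.Binary.Definitions using (Symmetric; DecidableEquality)
open import Relation.Binary.PropositionalEquality
  using (_≡_; _≢_; refl; sym; trans; cong; cong₂; subst; ≢-sym)
open import Relation.Nullary using (¬_; yes; no)

↔-injective : ∀ {A B : Set} (e : A ↔ B) → Injective _≡_ _≡_ (Inverse.to e)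
↔-injective e = Injection.injective (↔⇒↣ e)

cantor-schröder-bernstein-↔ : ∀ {A B : Set} {m n} → A ↔ Fin m → B ↔ Fin n →
  {f : A → B} → Injective _≡_ _≡_ f → {g : B → A} → Injective _≡_ _≡_ g → m ≡ n
cantor-schröder-bernstein-↔ eA eB f-inj g-inj = cantor-schröder-bernstein
  (↔-injective (↔-sym eA) ∘ f-inj ∘ ↔-injective eB)
  (↔-injective (↔-sym eB) ∘ g-inj ∘ ↔-injective eA)

lookup-tabulate′ : ∀ {A : Set} {n} (f : Fin n → A) i →
  lookup (tabulate f) i ≡ f (cast (length-tabulate f) i)
lookup-tabulate′ {n = suc _} f zero    = refl
lookup-tabulate′ {n = suc _} f (suc i) = lookup-tabulate′ (f ∘ suc) i

SameEdge-swap : ∀ {A : Set} {u v a b : A} → SameEdge u v a b → SameEdge v u a b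
SameEdge-swap (inj₁ (u≡a , v≡b)) = inj₂ (v≡b , u≡a)
SameEdge-swap (inj₂ (u≡b , v≡a)) = inj₁ (v≡a , u≡b)

EdgeOf-swap : ∀ {G : Graph} {u v : V G} (c : C4In G) → EdgeOf {G} u v c → EdgeOf {G} v u c
EdgeOf-swap _ = ⊎-map SameEdge-swap (⊎-map SameEdge-swap (⊎-map SameEdge-swap SameEdge-swap))

C4Decomposition-fromIndex : ∀ {G : Graph} {J : Set} {n} → J ↔ Fin n →
  (cycle : J → C4In G) (cycleOf : ∀ u v → Adj G u v → J) →
  (∀ u v (u~v : Adj G u v) → EdgeOf {G} u v (cycle (cycleOf u v u~v))) →
  (∀ u v (u~v : Adj G u v) j → EdgeOf {G} u v (cycle j) → j ≡ cycleOf u v u~v) →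
  C4Decomposition G
C4Decomposition-fromIndex {G} {J} enum cycle cycleOf covers unique =
  record { cycles = cycles ; exactlyOnce = exactlyOnce }
  where
  open Inverse enum

  cycles : List (C4In G)
  cycles = tabulate (cycle ∘ from)

  n≡ = length-tabulate (cycle ∘ from)

  index : J → Fin (length cycles)
  index j = cast (sym n≡) (to j)

  position : Fin (length cycles) → J
  position i = from (cast n≡ i)

  lookup-position : ∀ i → lookup cycles i ≡ cycle (position i)
  lookup-position = lookup-tabulate′ (cycle ∘ from)

  position-index : ∀ j → position (index j) ≡ j
  position-index j = trans (cong from (cast-involutive n≡ (sym n≡) (to j))) (strictlyInverseʳ j)

  index-position : ∀ i → index (position i) ≡ i
  index-position i =
    trans (cong (cast (sym n≡)) (strictlyInverseˡ (cast n≡ i))) (cast-involutive (sym n≡) n≡ i)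

  exactlyOnce : ∀ u v → Adj G u v → Σ (Fin (length cycles)) λ i →
    EdgeOf {G} u v (lookup cycles i) × (∀ i′ → EdgeOf {G} u v (lookup cycles i′) → i′ ≡ i)
  exactlyOnce u v u~v = index c , on-c , only-c
    where
    c = cycleOf u v u~v

    on-c : EdgeOf {G} u v (lookup cycles (index c))
    on-c = subst (EdgeOf {G} u v)
      (sym (trans (lookup-position (index c)) (cong cycle (position-index c)))) (covers u v u~v)

    only-c : ∀ i′ → EdgeOf {G} u v (lookup cycles i′) → i′ ≡ index c
    only-c i′ e = trans (sym (index-position i′))
      (cong index (unique u v u~v (position i′) (subst (EdgeOf {G} u v) (lookup-position i′) e)))

next prev : Fin 3 → Fin 3
next 0F = 1F
next 1F = 2F
next 2F = 0F
prev 0F = 2F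
prev 1F = 0F
prev 2F = 1F

m≢next : ∀ m → m ≢ next m
m≢next 0F ()
m≢next 1F ()
m≢next 2F ()

m≢prev : ∀ m → m ≢ prev m
m≢prev 0F ()
m≢prev 1F ()
m≢prev 2F ()

next≢prev : ∀ m → next m ≢ prev m
next≢prev 0F ()
next≢prev 1F ()
next≢prev 2F ()

≢⇒next⊎prev : ∀ {m c : Fin 3} → c ≢ m → c ≡ next m ⊎ c ≡ prev m
≢⇒next⊎prev {0F} {0F} c≢m = ⊥-elim (c≢m refl)
≢⇒next⊎prev {1F} {1F} c≢m = ⊥-elim (c≢m refl)
≢⇒next⊎prev {2F} {2F} c≢m = ⊥-elim (c≢m refl)
≢⇒next⊎prev {0F} {1F} _ = inj₁ refl
≢⇒next⊎prev {1F} {2F} _ = inj₁ refl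
≢⇒next⊎prev {2F} {0F} _ = inj₁ refl
≢⇒next⊎prev {0F} {2F} _ = inj₂ refl
≢⇒next⊎prev {1F} {0F} _ = inj₂ refl
≢⇒next⊎prev {2F} {1F} _ = inj₂ refl

C₃-adjacent : ∀ {a b : Fin 3} → a ≢ b → Adj (C 3) a b
C₃-adjacent {a} a≢b with ≢⇒next⊎prev (≢-sym a≢b)
C₃-adjacent {0F} _ | inj₁ refl = inj₁ refl
C₃-adjacent {1F} _ | inj₁ refl = inj₁ refl
C₃-adjacent {2F} _ | inj₁ refl = inj₁ refl
C₃-adjacent {0F} _ | inj₂ refl = inj₂ refl
C₃-adjacent {1F} _ | inj₂ refl = inj₂ refl
C₃-adjacent {2F} _ | inj₂ refl = inj₂ refl

C₃-irreflexive : ∀ {a : Fin 3} → ¬ Adj (C 3) a a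
C₃-irreflexive {0F} (inj₁ ())
C₃-irreflexive {0F} (inj₂ ())
C₃-irreflexive {1F} (inj₁ ())
C₃-irreflexive {1F} (inj₂ ())
C₃-irreflexive {2F} (inj₁ ())
C₃-irreflexive {2F} (inj₂ ())

C₃-adj⇔≢ : ∀ {a b : Fin 3} → Adj (C 3) a b ⇔ a ≢ b
C₃-adj⇔≢ = mk⇔ (λ { a~b refl → C₃-irreflexive a~b }) C₃-adjacent

C-sym : ∀ k .{{_ : NonZero k}} → Symmetric (Adj (C k))
C-sym _ (inj₁ e) = inj₂ e
C-sym _ (inj₂ e) = inj₁ e

⊗-sym : ∀ {G H : Graph} → Symmetric (Adj G) → Symmetric (Adj H) → Symmetric (Adj (G ⊗ H))
⊗-sym G-sym H-sym (g~g′ , h~h′) = G-sym g~g′ , H-sym h~h′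

-- Counting darts

record DartEnumeration (G : Graph) (d : ℕ) : Set where
  field
    dart : Fin d → V G × V G
    dart-injective : Injective _≡_ _≡_ dart
    dart-adjacent : ∀ k → uncurry (Adj G) (dart k)
    dartIndex : ∀ u v → Adj G u v → Fin d
    dart-dartIndex : ∀ u v (u~v : Adj G u v) → dart (dartIndex u v u~v) ≡ (u , v)

complete-darts : ∀ {n} (R : Fin (suc n) → Fin (suc n) → Set) → (∀ {u v} → R u v ⇔ u ≢ v) →
  DartEnumeration (record { V = Fin (suc n) ; Adj = R }) (suc n * n)
complete-darts {n} R R⇔≢ = record
  { dart = dart ∘ to
  ; dart-injective = ↔-injective *↔× ∘ dart-injective
  ; dart-adjacent = λ k → Equivalence.from R⇔≢ (punchIn-≢ (proj₁ (to k)) (proj₂ (to k)))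
  ; dartIndex = λ u v u~v → from (u , punchOut (Equivalence.to R⇔≢ u~v))
  ; dart-dartIndex = λ u v u~v →
      trans (cong dart (strictlyInverseˡ _)) (cong (u ,_) (punchIn-punchOut (Equivalence.to R⇔≢ u~v)))
  }
  where
  open Inverse (*↔× {suc n} {n})

  dart : Fin (suc n) × Fin n → Fin (suc n) × Fin (suc n)
  dart (u , w) = u , punchIn u w

  dart-injective : Injective _≡_ _≡_ dart
  dart-injective {u , w} {u′ , w′} e with ,-injectiveˡ e
  ... | refl = cong (u ,_) (punchIn-injective u w w′ (,-injectiveʳ e))

  punchIn-≢ : ∀ u w → u ≢ punchIn u w
  punchIn-≢ u w = punchInᵢ≢i u w ∘ sym

⊗-darts : ∀ {G H : Graph} {d e} → DartEnumeration G d → DartEnumeration H e →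
  DartEnumeration (G ⊗ H) (d * e)
⊗-darts {G} {H} {d} {e} EG EH = record
  { dart = dart ∘ to
  ; dart-injective = ↔-injective *↔× ∘ dart-injective
  ; dart-adjacent = λ k → EG.dart-adjacent (proj₁ (to k)) , EH.dart-adjacent (proj₂ (to k))
  ; dartIndex = dartIndex
  ; dart-dartIndex = dart-dartIndex
  }
  where
  module EG = DartEnumeration EG
  module EH = DartEnumeration EH
  open Inverse (*↔× {d} {e})

  zip : (V G × V G) × (V H × V H) → (V G × V H) × (V G × V H)
  zip ((g , g′) , (h , h′)) = (g , h) , (g′ , h′)

  unzip : (V G × V H) × (V G × V H) → (V G × V G) × (V H × V H)
  unzip ((g , h) , (g′ , h′)) = (g , g′) , (h , h′)

  dart : Fin d × Fin e → (V G × V H) × (V G × V H)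
  dart (i , j) = zip (EG.dart i , EH.dart j)

  dart-injective : Injective _≡_ _≡_ dart
  dart-injective eq = cong₂ _,_
    (EG.dart-injective (,-injectiveˡ (cong unzip eq)))
    (EH.dart-injective (,-injectiveʳ (cong unzip eq)))

  dartIndex : ∀ x y → Adj (G ⊗ H) x y → Fin (d * e)
  dartIndex (g , h) (g′ , h′) (g~g′ , h~h′) = from (EG.dartIndex g g′ g~g′ , EH.dartIndex h h′ h~h′)

  dart-dartIndex : ∀ x y (x~y : Adj (G ⊗ H) x y) → dart (to (dartIndex x y x~y)) ≡ (x , y)
  dart-dartIndex (g , h) (g′ , h′) (g~g′ , h~h′) = trans (cong dart (strictlyInverseˡ _))
    (cong zip (cong₂ _,_ (EG.dart-dartIndex g g′ g~g′) (EH.dart-dartIndex h h′ h~h′)))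

C₃-darts : DartEnumeration (C 3) 6
C₃-darts = complete-darts (Adj (C 3)) (λ {_} {_} → C₃-adj⇔≢)

K-darts : ∀ n → DartEnumeration (K (suc n)) (suc n * n)
K-darts n = complete-darts _≢_ (λ {_} {_} → mk⇔ id id)

neighbour : Fin 4 → Fin 2 → Fin 4
neighbour 0F 0F = 1F
neighbour 1F 0F = 2F
neighbour 2F 0F = 3F
neighbour 3F 0F = 0F
neighbour 0F 1F = 3F
neighbour 1F 1F = 0F
neighbour 2F 1F = 1F
neighbour 3F 1F = 2F

neighbour-injective : ∀ k → Injective _≡_ _≡_ (neighbour k)
neighbour-injective _ {0F} {0F} _ = refl
neighbour-injective _ {1F} {1F} _ = refl
neighbour-injective 0F {0F} {1F} ()
neighbour-injective 0F {1F} {0F} ()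
neighbour-injective 1F {0F} {1F} ()
neighbour-injective 1F {1F} {0F} ()
neighbour-injective 2F {0F} {1F} ()
neighbour-injective 2F {1F} {0F} ()
neighbour-injective 3F {0F} {1F} ()
neighbour-injective 3F {1F} {0F} ()

module _ {G : Graph} where

  corner : C4In G → Fin 4 → V G
  corner c 0F = v₀ c
  corner c 1F = v₁ c
  corner c 2F = v₂ c
  corner c 3F = v₃ c

  corner-injective : ∀ c → Injective _≡_ _≡_ (corner c)
  corner-injective c {0F} {0F} _ = refl
  corner-injective c {1F} {1F} _ = refl
  corner-injective c {2F} {2F} _ = refl
  corner-injective c {3F} {3F} _ = refl
  corner-injective c {0F} {1F} e = ⊥-elim (d01 c e)
  corner-injective c {0F} {2F} e = ⊥-elim (d02 c e)
  corner-injective c {0F} {3F} e = ⊥-elim (d03 c e)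
  corner-injective c {1F} {2F} e = ⊥-elim (d12 c e)
  corner-injective c {1F} {3F} e = ⊥-elim (d13 c e)
  corner-injective c {2F} {3F} e = ⊥-elim (d23 c e)
  corner-injective c {1F} {0F} e = ⊥-elim (d01 c (sym e))
  corner-injective c {2F} {0F} e = ⊥-elim (d02 c (sym e))
  corner-injective c {3F} {0F} e = ⊥-elim (d03 c (sym e))
  corner-injective c {2F} {1F} e = ⊥-elim (d12 c (sym e))
  corner-injective c {3F} {1F} e = ⊥-elim (d13 c (sym e))
  corner-injective c {3F} {2F} e = ⊥-elim (d23 c (sym e))

  cycleDart : C4In G → Fin 4 × Fin 2 → V G × V G
  cycleDart c (k , s) = corner c k , corner c (neighbour k s)

  cycleDart-injective : ∀ c → Injective _≡_ _≡_ (cycleDart c)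
  cycleDart-injective c {k , _} {k′ , _} e with corner-injective c {k} {k′} (,-injectiveˡ e)
  ... | refl = cong (k ,_) (neighbour-injective k (corner-injective c (,-injectiveʳ e)))

  cycleDart-adjacent : Symmetric (Adj G) → ∀ c p → uncurry (Adj G) (cycleDart c p)
  cycleDart-adjacent _ c (0F , 0F) = e01 c
  cycleDart-adjacent _ c (1F , 0F) = e12 c
  cycleDart-adjacent _ c (2F , 0F) = e23 c
  cycleDart-adjacent _ c (3F , 0F) = e30 c
  cycleDart-adjacent G-sym c (1F , 1F) = G-sym (e01 c)
  cycleDart-adjacent G-sym c (2F , 1F) = G-sym (e12 c)
  cycleDart-adjacent G-sym c (3F , 1F) = G-sym (e23 c)
  cycleDart-adjacent G-sym c (0F , 1F) = G-sym (e30 c)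

  cycleDart-edge : ∀ c p → uncurry (λ u v → EdgeOf {G} u v c) (cycleDart c p)
  cycleDart-edge c (0F , 0F) = inj₁ (inj₁ (refl , refl))
  cycleDart-edge c (1F , 1F) = inj₁ (inj₂ (refl , refl))
  cycleDart-edge c (1F , 0F) = inj₂ (inj₁ (inj₁ (refl , refl)))
  cycleDart-edge c (2F , 1F) = inj₂ (inj₁ (inj₂ (refl , refl)))
  cycleDart-edge c (2F , 0F) = inj₂ (inj₂ (inj₁ (inj₁ (refl , refl))))
  cycleDart-edge c (3F , 1F) = inj₂ (inj₂ (inj₁ (inj₂ (refl , refl))))
  cycleDart-edge c (3F , 0F) = inj₂ (inj₂ (inj₂ (inj₁ (refl , refl))))
  cycleDart-edge c (0F , 1F) = inj₂ (inj₂ (inj₂ (inj₂ (refl , refl))))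

  EdgeOf⇒cycleDart : ∀ {u v} c → EdgeOf {G} u v c → ∃ λ p → cycleDart c p ≡ (u , v)
  EdgeOf⇒cycleDart c (inj₁ (inj₁ (refl , refl))) = (0F , 0F) , refl
  EdgeOf⇒cycleDart c (inj₁ (inj₂ (refl , refl))) = (1F , 1F) , refl
  EdgeOf⇒cycleDart c (inj₂ (inj₁ (inj₁ (refl , refl)))) = (1F , 0F) , refl
  EdgeOf⇒cycleDart c (inj₂ (inj₁ (inj₂ (refl , refl)))) = (2F , 1F) , refl
  EdgeOf⇒cycleDart c (inj₂ (inj₂ (inj₁ (inj₁ (refl , refl))))) = (2F , 0F) , refl
  EdgeOf⇒cycleDart c (inj₂ (inj₂ (inj₁ (inj₂ (refl , refl))))) = (3F , 1F) , refl
  EdgeOf⇒cycleDart c (inj₂ (inj₂ (inj₂ (inj₁ (refl , refl))))) = (3F , 0F) , refl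
  EdgeOf⇒cycleDart c (inj₂ (inj₂ (inj₂ (inj₂ (refl , refl))))) = (0F , 1F) , refl

C4Decomposition-darts : ∀ {G : Graph} {d} → Symmetric (Adj G) → (D : C4Decomposition G) →
  DartEnumeration G d → length (C4Decomposition.cycles D) * 8 ≡ d
C4Decomposition-darts {G} {d} G-sym D E =
  cantor-schröder-bernstein-↔ positions ↔-refl
    {f = dartOf} dartOf-injective {g = positionOf} positionOf-injective
  where
  open C4Decomposition D
  open DartEnumeration E

  Position = Fin (length cycles) × (Fin 4 × Fin 2)

  positions : Position ↔ Fin (length cycles * 8)
  positions = ↔-sym (↔-trans *↔× (↔-refl ×-↔ *↔× {4} {2}))

  arc : Position → V G × V G
  arc (i , p) = cycleDart (lookup cycles i) p

  arc-adjacent : ∀ x → uncurry (Adj G) (arc x)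
  arc-adjacent (i , p) = cycleDart-adjacent G-sym (lookup cycles i) p

  arc-edge : ∀ {i p u v} → arc (i , p) ≡ (u , v) → EdgeOf {G} u v (lookup cycles i)
  arc-edge {i} {p} e = subst (uncurry λ u v → EdgeOf {G} u v (lookup cycles i)) e (cycleDart-edge _ p)

  same-cycle : ∀ {i p i′ p′} → arc (i , p) ≡ arc (i′ , p′) → i ≡ i′
  same-cycle {i} {p} {i′} {p′} e =
    trans (only i (arc-edge {i} {p} refl)) (sym (only i′ (arc-edge {i′} {p′} (sym e))))
    where only = proj₂ (proj₂ (exactlyOnce _ _ (arc-adjacent (i , p))))

  arc-injective : Injective _≡_ _≡_ arc
  arc-injective {i , p} {i′ , p′} e with same-cycle {i} {p} {i′} {p′} e
  ... | refl = cong (i ,_) (cycleDart-injective (lookup cycles i) e)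

  dartOf : Position → Fin d
  dartOf x = dartIndex _ _ (arc-adjacent x)

  dartOf-injective : Injective _≡_ _≡_ dartOf
  dartOf-injective {x} {y} e = arc-injective
    (trans (sym (dart-dartIndex _ _ (arc-adjacent x)))
      (trans (cong dart e) (dart-dartIndex _ _ (arc-adjacent y))))

  positionOf : Fin d → Position
  positionOf k = proj₁ cycle , proj₁ (EdgeOf⇒cycleDart _ (proj₁ (proj₂ cycle)))
    where cycle = exactlyOnce _ _ (dart-adjacent k)

  arc-positionOf : ∀ k → arc (positionOf k) ≡ dart k
  arc-positionOf k = proj₂ (EdgeOf⇒cycleDart _ (proj₁ (proj₂ (exactlyOnce _ _ (dart-adjacent k)))))

  positionOf-injective : Injective _≡_ _≡_ positionOf
  positionOf-injective {k} {k′} e =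
    dart-injective (trans (sym (arc-positionOf k)) (trans (cong arc e) (arc-positionOf k′)))

-- Paths of length two

record P₃In (H : Graph) : Set where
  field
    left centre right : V H
    left≢centre : left ≢ centre
    right≢centre : right ≢ centre
    left≢right : left ≢ right
    left~centre : Adj H left centre
    right~centre : Adj H right centre
open P₃In public

OnPath : ∀ {H : Graph} → V H → V H → P₃In H → Set
OnPath u v P = SameEdge u v (left P) (centre P) ⊎ SameEdge u v (centre P) (right P)

record P₃Decomposition (H : Graph) : Set₁ where
  field
    Path : Set
    size : ℕ
    enumeration : Path ↔ Fin size
    path : Path → P₃In H
    pathOf : ∀ u v → Adj H u v → Path
    pathOf-covers : ∀ u v (u~v : Adj H u v) → OnPath {H} u v (path (pathOf u v u~v))
    pathOf-unique : ∀ u v (u~v : Adj H u v) p → OnPath {H} u v (path p) → p ≡ pathOf u v u~v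

module _ {H : Graph} (H-sym : Symmetric (Adj H)) (_≟ᴴ_ : DecidableEquality (V H))
         (D : P₃Decomposition H) where

  open P₃Decomposition D

  private
    G = C 3 ⊗ H

  cycle : Path × Fin 3 → C4In G
  cycle (p , m) = record
    { v₀ = m , left P ; v₁ = next m , centre P ; v₂ = m , right P ; v₃ = prev m , centre P
    ; d01 = m≢next m ∘ cong proj₁
    ; d02 = left≢right P ∘ cong proj₂
    ; d03 = m≢prev m ∘ cong proj₁
    ; d12 = m≢next m ∘ sym ∘ cong proj₁
    ; d13 = next≢prev m ∘ cong proj₁
    ; d23 = m≢prev m ∘ cong proj₁
    ; e01 = C₃-adjacent (m≢next m) , left~centre P
    ; e12 = C₃-adjacent (m≢next m ∘ sym) , H-sym (right~centre P)
    ; e23 = C₃-adjacent (m≢prev m) , right~centre P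
    ; e30 = C₃-adjacent (m≢prev m ∘ sym) , H-sym (left~centre P)
    }
    where P = path p

  -- The cycle through the edge (a , u) — (b , v) sits in the layer of the
  -- endpoint that is not the centre of the path through u — v.
  layer : Fin 3 → Fin 3 → V H → P₃In H → Fin 3
  layer a b u P with u ≟ᴴ centre P
  ... | yes _ = b
  ... | no _ = a

  layer-centre : ∀ {a b u P} → u ≡ centre P → layer a b u P ≡ b
  layer-centre {u = u} {P} u≡c with u ≟ᴴ centre P
  ... | yes _ = refl
  ... | no u≢c = ⊥-elim (u≢c u≡c)

  layer-end : ∀ {a b u P} → u ≢ centre P → layer a b u P ≡ a
  layer-end {u = u} {P} u≢c with u ≟ᴴ centre P
  ... | yes u≡c = ⊥-elim (u≢c u≡c)
  ... | no _ = refl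

  cycleOf : ∀ x y → Adj G x y → Path × Fin 3
  cycleOf (a , u) (b , v) (_ , u~v) = p , layer a b u (path p)
    where p = pathOf u v u~v

  left-edge : ∀ p {m c u v} → c ≢ m → u ≡ left (path p) → v ≡ centre (path p) →
    EdgeOf {G} (m , u) (c , v) (cycle (p , m))
  left-edge p c≢m refl refl with ≢⇒next⊎prev c≢m
  ... | inj₁ refl = inj₁ (inj₁ (refl , refl))
  ... | inj₂ refl = inj₂ (inj₂ (inj₂ (inj₂ (refl , refl))))

  right-edge : ∀ p {m c u v} → c ≢ m → u ≡ right (path p) → v ≡ centre (path p) →
    EdgeOf {G} (m , u) (c , v) (cycle (p , m))
  right-edge p c≢m refl refl with ≢⇒next⊎prev c≢m
  ... | inj₁ refl = inj₂ (inj₁ (inj₂ (refl , refl)))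
  ... | inj₂ refl = inj₂ (inj₂ (inj₁ (inj₁ (refl , refl))))

  cycleOf-covers : ∀ x y (x~y : Adj G x y) → EdgeOf {G} x y (cycle (cycleOf x y x~y))
  cycleOf-covers (a , u) (b , v) (a~b , u~v) = covers (pathOf-covers u v u~v)
    where
    p = pathOf u v u~v
    P = path p
    a≢b = Equivalence.to C₃-adj⇔≢ a~b

    in-layer : ∀ {m} → layer a b u P ≡ m → EdgeOf {G} (a , u) (b , v) (cycle (p , m)) →
      EdgeOf {G} (a , u) (b , v) (cycle (p , layer a b u P))
    in-layer eq = subst (λ m → EdgeOf {G} (a , u) (b , v) (cycle (p , m))) (sym eq)

    covers : OnPath {H} u v P → EdgeOf {G} (a , u) (b , v) (cycle (p , layer a b u P))
    covers (inj₁ (inj₁ (u≡l , v≡c))) =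
      in-layer (layer-end (left≢centre P ∘ trans (sym u≡l))) (left-edge p (≢-sym a≢b) u≡l v≡c)
    covers (inj₁ (inj₂ (u≡c , v≡l))) =
      in-layer (layer-centre u≡c) (EdgeOf-swap (cycle (p , b)) (left-edge p a≢b v≡l u≡c))
    covers (inj₂ (inj₁ (u≡c , v≡r))) =
      in-layer (layer-centre u≡c) (EdgeOf-swap (cycle (p , b)) (right-edge p a≢b v≡r u≡c))
    covers (inj₂ (inj₂ (u≡r , v≡c))) =
      in-layer (layer-end (right≢centre P ∘ trans (sym u≡r))) (right-edge p (≢-sym a≢b) u≡r v≡c)

  cycleOf-≡ : ∀ {a b u v} (x~y : Adj G (a , u) (b , v)) {p m} → OnPath {H} u v (path p) →
    layer a b u (path p) ≡ m → (p , m) ≡ cycleOf (a , u) (b , v) x~y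
  cycleOf-≡ {a} {b} {u} {v} x~y {p} on eq =
    cong₂ _,_ p≡ (trans (sym eq) (cong (λ q → layer a b u (path q)) p≡))
    where p≡ = pathOf-unique u v (proj₂ x~y) p on

  cycleOf-unique : ∀ x y (x~y : Adj G x y) j → EdgeOf {G} x y (cycle j) → j ≡ cycleOf x y x~y
  cycleOf-unique _ _ x~y (p , _) (inj₁ (inj₁ (refl , refl))) =
    cycleOf-≡ x~y (inj₁ (inj₁ (refl , refl))) (layer-end (left≢centre (path p)))
  cycleOf-unique _ _ x~y (p , _) (inj₁ (inj₂ (refl , refl))) =
    cycleOf-≡ x~y (inj₁ (inj₂ (refl , refl))) (layer-centre refl)
  cycleOf-unique _ _ x~y (p , _) (inj₂ (inj₁ (inj₁ (refl , refl)))) =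
    cycleOf-≡ x~y (inj₂ (inj₁ (refl , refl))) (layer-centre refl)
  cycleOf-unique _ _ x~y (p , _) (inj₂ (inj₁ (inj₂ (refl , refl)))) =
    cycleOf-≡ x~y (inj₂ (inj₂ (refl , refl))) (layer-end (right≢centre (path p)))
  cycleOf-unique _ _ x~y (p , _) (inj₂ (inj₂ (inj₁ (inj₁ (refl , refl))))) =
    cycleOf-≡ x~y (inj₂ (inj₂ (refl , refl))) (layer-end (right≢centre (path p)))
  cycleOf-unique _ _ x~y (p , _) (inj₂ (inj₂ (inj₁ (inj₂ (refl , refl))))) =
    cycleOf-≡ x~y (inj₂ (inj₁ (refl , refl))) (layer-centre refl)
  cycleOf-unique _ _ x~y (p , _) (inj₂ (inj₂ (inj₂ (inj₁ (refl , refl))))) =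
    cycleOf-≡ x~y (inj₁ (inj₂ (refl , refl))) (layer-centre refl)
  cycleOf-unique _ _ x~y (p , _) (inj₂ (inj₂ (inj₂ (inj₂ (refl , refl))))) =
    cycleOf-≡ x~y (inj₁ (inj₁ (refl , refl))) (layer-end (left≢centre (path p)))

  C₃⊗-C4Decomposition : C4Decomposition G
  C₃⊗-C4Decomposition = C4Decomposition-fromIndex (↔-trans (enumeration ×-↔ ↔-refl) (↔-sym *↔×))
    cycle cycleOf cycleOf-covers cycleOf-unique

-- Decomposing complete graphs into paths of length two

Complete : Set → Graph
Complete A = record { V = A ; Adj = _≢_ }

P₃-complete : ∀ {A : Set} (l c r : A) → l ≢ c → r ≢ c → l ≢ r → P₃In (Complete A)
P₃-complete l c r l≢c r≢c l≢r = record
  { left = l ; centre = c ; right = r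
  ; left≢centre = l≢c ; right≢centre = r≢c ; left≢right = l≢r
  ; left~centre = l≢c ; right~centre = r≢c
  }

P₃In-map : ∀ {A B : Set} (f : A → B) → Injective _≡_ _≡_ f →
  P₃In (Complete A) → P₃In (Complete B)
P₃In-map f f-inj P = P₃-complete (f (left P)) (f (centre P)) (f (right P))
  (left≢centre P ∘ f-inj) (right≢centre P ∘ f-inj) (left≢right P ∘ f-inj)

SameEdge-map : ∀ {A B : Set} (f : A → B) {u v a b} →
  SameEdge u v a b → SameEdge (f u) (f v) (f a) (f b)
SameEdge-map f (inj₁ (refl , refl)) = inj₁ (refl , refl)
SameEdge-map f (inj₂ (refl , refl)) = inj₂ (refl , refl)

OnPath-map : ∀ {A B : Set} (f : A → B) (f-inj : Injective _≡_ _≡_ f) {u v} P →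
  OnPath {Complete A} u v P → OnPath {Complete B} (f u) (f v) (P₃In-map f f-inj P)
OnPath-map f _ _ = ⊎-map (SameEdge-map f) (SameEdge-map f)

transport : ∀ {A B : Set} → A ↔ B → P₃Decomposition (Complete A) → P₃Decomposition (Complete B)
transport e D = record
  { Path = Path
  ; size = size
  ; enumeration = enumeration
  ; path = P₃In-map to (↔-injective e) ∘ path
  ; pathOf = λ u v u≢v → pathOf (from u) (from v) (u≢v ∘ ↔-injective (↔-sym e))
  ; pathOf-covers = λ u v _ → ⊎-map SameEdge-to SameEdge-to (pathOf-covers (from u) (from v) _)
  ; pathOf-unique = λ u v _ p →
      pathOf-unique (from u) (from v) _ p ∘ ⊎-map SameEdge-from SameEdge-from
  }
  where
  open Inverse e
  open P₃Decomposition D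

  SameEdge-to : ∀ {u v a b} → SameEdge (from u) (from v) a b → SameEdge u v (to a) (to b)
  SameEdge-to {u} {v} (inj₁ (refl , refl)) = inj₁ (sym (strictlyInverseˡ u) , sym (strictlyInverseˡ v))
  SameEdge-to {u} {v} (inj₂ (refl , refl)) = inj₂ (sym (strictlyInverseˡ u) , sym (strictlyInverseˡ v))

  SameEdge-from : ∀ {u v a b} → SameEdge u v (to a) (to b) → SameEdge (from u) (from v) a b
  SameEdge-from {a = a} {b} (inj₁ (refl , refl)) = inj₁ (strictlyInverseʳ a , strictlyInverseʳ b)
  SameEdge-from {a = a} {b} (inj₂ (refl , refl)) = inj₂ (strictlyInverseʳ b , strictlyInverseʳ a)

P₃Decomposition-subsingleton : ∀ {A : Set} → (∀ (a b : A) → a ≡ b) → P₃Decomposition (Complete A)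
P₃Decomposition-subsingleton all-equal = record
  { Path = ⊥
  ; size = 0
  ; enumeration = ↔-sym 0↔⊥
  ; path = λ ()
  ; pathOf = λ u v u≢v → ⊥-elim (u≢v (all-equal u v))
  ; pathOf-covers = λ u v u≢v → ⊥-elim (u≢v (all-equal u v))
  ; pathOf-unique = λ _ _ _ ()
  }

K₄-P₃Decomposition : P₃Decomposition (K 4)
K₄-P₃Decomposition = record
  { Path = Fin 3
  ; size = 3
  ; enumeration = ↔-refl
  ; path = path
  ; pathOf = pathOf
  ; pathOf-covers = covers
  ; pathOf-unique = unique
  }
  where
  path : Fin 3 → P₃In (K 4)
  path 0F = P₃-complete 0F 1F 2F (λ ()) (λ ()) (λ ())
  path 1F = P₃-complete 0F 2F 3F (λ ()) (λ ()) (λ ())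
  path 2F = P₃-complete 0F 3F 1F (λ ()) (λ ()) (λ ())

  pathOf : ∀ (u v : Fin 4) → u ≢ v → Fin 3
  pathOf 0F 1F _ = 0F
  pathOf 1F 0F _ = 0F
  pathOf 1F 2F _ = 0F
  pathOf 2F 1F _ = 0F
  pathOf 0F 2F _ = 1F
  pathOf 2F 0F _ = 1F
  pathOf 2F 3F _ = 1F
  pathOf 3F 2F _ = 1F
  pathOf 0F 3F _ = 2F
  pathOf 3F 0F _ = 2F
  pathOf 3F 1F _ = 2F
  pathOf 1F 3F _ = 2F
  pathOf 0F 0F 0≢0 = ⊥-elim (0≢0 refl)
  pathOf 1F 1F 1≢1 = ⊥-elim (1≢1 refl)
  pathOf 2F 2F 2≢2 = ⊥-elim (2≢2 refl)
  pathOf 3F 3F 3≢3 = ⊥-elim (3≢3 refl)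

  covers : ∀ u v (u≢v : u ≢ v) → OnPath {K 4} u v (path (pathOf u v u≢v))
  covers 0F 1F _ = inj₁ (inj₁ (refl , refl))
  covers 1F 0F _ = inj₁ (inj₂ (refl , refl))
  covers 1F 2F _ = inj₂ (inj₁ (refl , refl))
  covers 2F 1F _ = inj₂ (inj₂ (refl , refl))
  covers 0F 2F _ = inj₁ (inj₁ (refl , refl))
  covers 2F 0F _ = inj₁ (inj₂ (refl , refl))
  covers 2F 3F _ = inj₂ (inj₁ (refl , refl))
  covers 3F 2F _ = inj₂ (inj₂ (refl , refl))
  covers 0F 3F _ = inj₁ (inj₁ (refl , refl))
  covers 3F 0F _ = inj₁ (inj₂ (refl , refl))
  covers 3F 1F _ = inj₂ (inj₁ (refl , refl))
  covers 1F 3F _ = inj₂ (inj₂ (refl , refl))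
  covers 0F 0F 0≢0 = ⊥-elim (0≢0 refl)
  covers 1F 1F 1≢1 = ⊥-elim (1≢1 refl)
  covers 2F 2F 2≢2 = ⊥-elim (2≢2 refl)
  covers 3F 3F 3≢3 = ⊥-elim (3≢3 refl)

  unique : ∀ u v (u≢v : u ≢ v) p → OnPath {K 4} u v (path p) → p ≡ pathOf u v u≢v
  unique _ _ _ 0F (inj₁ (inj₁ (refl , refl))) = refl
  unique _ _ _ 0F (inj₁ (inj₂ (refl , refl))) = refl
  unique _ _ _ 0F (inj₂ (inj₁ (refl , refl))) = refl
  unique _ _ _ 0F (inj₂ (inj₂ (refl , refl))) = refl
  unique _ _ _ 1F (inj₁ (inj₁ (refl , refl))) = refl
  unique _ _ _ 1F (inj₁ (inj₂ (refl , refl))) = refl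
  unique _ _ _ 1F (inj₂ (inj₁ (refl , refl))) = refl
  unique _ _ _ 1F (inj₂ (inj₂ (refl , refl))) = refl
  unique _ _ _ 2F (inj₁ (inj₁ (refl , refl))) = refl
  unique _ _ _ 2F (inj₁ (inj₂ (refl , refl))) = refl
  unique _ _ _ 2F (inj₂ (inj₁ (refl , refl))) = refl
  unique _ _ _ 2F (inj₂ (inj₂ (refl , refl))) = refl

extend : ∀ {m} → P₃Decomposition (K m) → P₃Decomposition (Complete (Fin 4 ⊎ Fin m))
extend {m} D = record
  { Path = Fin 3 ⊎ Path ⊎ Fin m × Fin 2
  ; size = 3 + (size + m * 2)
  ; enumeration =
      ↔-sym (↔-trans (+↔⊎ {3})
        (↔-refl ⊎-↔ ↔-trans (+↔⊎ {size}) (↔-sym enumeration ⊎-↔ *↔×)))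
  ; path = path′
  ; pathOf = pathOf′
  ; pathOf-covers = covers
  ; pathOf-unique = unique
  }
  where
  module K₄ = P₃Decomposition K₄-P₃Decomposition
  open P₃Decomposition D

  W = Fin 4 ⊎ Fin m
  Path′ = Fin 3 ⊎ Path ⊎ Fin m × Fin 2

  spoke : Fin m → Fin 2 → P₃In (Complete W)
  spoke x 0F = P₃-complete (inj₁ 0F) (inj₂ x) (inj₁ 1F) (λ ()) (λ ()) (λ ())
  spoke x 1F = P₃-complete (inj₁ 2F) (inj₂ x) (inj₁ 3F) (λ ()) (λ ()) (λ ())

  spokeThrough : Fin 4 → Fin 2
  spokeThrough 0F = 0F
  spokeThrough 1F = 0F
  spokeThrough 2F = 1F
  spokeThrough 3F = 1F

  path′ : Path′ → P₃In (Complete W)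
  path′ (inj₁ p) = P₃In-map inj₁ inj₁-injective (K₄.path p)
  path′ (inj₂ (inj₁ p)) = P₃In-map inj₂ inj₂-injective (path p)
  path′ (inj₂ (inj₂ (x , s))) = spoke x s

  pathOf′ : ∀ (u v : W) → u ≢ v → Path′
  pathOf′ (inj₁ q) (inj₁ q′) q≢q′ = inj₁ (K₄.pathOf q q′ (q≢q′ ∘ cong inj₁))
  pathOf′ (inj₂ x) (inj₂ y) x≢y = inj₂ (inj₁ (pathOf x y (x≢y ∘ cong inj₂)))
  pathOf′ (inj₁ q) (inj₂ x) _ = inj₂ (inj₂ (x , spokeThrough q))
  pathOf′ (inj₂ x) (inj₁ q) _ = inj₂ (inj₂ (x , spokeThrough q))

  covers : ∀ u v (u≢v : u ≢ v) → OnPath {Complete W} u v (path′ (pathOf′ u v u≢v))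
  covers (inj₁ q) (inj₁ q′) q≢q′ =
    OnPath-map inj₁ inj₁-injective (K₄.path (K₄.pathOf q q′ new≢)) (K₄.pathOf-covers q q′ new≢)
    where new≢ = q≢q′ ∘ cong inj₁
  covers (inj₂ x) (inj₂ y) x≢y =
    OnPath-map inj₂ inj₂-injective (path (pathOf x y old≢)) (pathOf-covers x y old≢)
    where old≢ = x≢y ∘ cong inj₂
  covers (inj₁ 0F) (inj₂ x) _ = inj₁ (inj₁ (refl , refl))
  covers (inj₁ 1F) (inj₂ x) _ = inj₂ (inj₂ (refl , refl))
  covers (inj₁ 2F) (inj₂ x) _ = inj₁ (inj₁ (refl , refl))
  covers (inj₁ 3F) (inj₂ x) _ = inj₂ (inj₂ (refl , refl))
  covers (inj₂ x) (inj₁ 0F) _ = inj₁ (inj₂ (refl , refl))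
  covers (inj₂ x) (inj₁ 1F) _ = inj₂ (inj₁ (refl , refl))
  covers (inj₂ x) (inj₁ 2F) _ = inj₁ (inj₂ (refl , refl))
  covers (inj₂ x) (inj₁ 3F) _ = inj₂ (inj₁ (refl , refl))

  unique : ∀ u v (u≢v : u ≢ v) p → OnPath {Complete W} u v (path′ p) → p ≡ pathOf′ u v u≢v
  unique _ _ _ (inj₁ p) (inj₁ (inj₁ (refl , refl))) =
    cong inj₁ (K₄.pathOf-unique _ _ _ p (inj₁ (inj₁ (refl , refl))))
  unique _ _ _ (inj₁ p) (inj₁ (inj₂ (refl , refl))) =
    cong inj₁ (K₄.pathOf-unique _ _ _ p (inj₁ (inj₂ (refl , refl))))
  unique _ _ _ (inj₁ p) (inj₂ (inj₁ (refl , refl))) =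
    cong inj₁ (K₄.pathOf-unique _ _ _ p (inj₂ (inj₁ (refl , refl))))
  unique _ _ _ (inj₁ p) (inj₂ (inj₂ (refl , refl))) =
    cong inj₁ (K₄.pathOf-unique _ _ _ p (inj₂ (inj₂ (refl , refl))))
  unique _ _ _ (inj₂ (inj₁ p)) (inj₁ (inj₁ (refl , refl))) =
    cong (inj₂ ∘ inj₁) (pathOf-unique _ _ _ p (inj₁ (inj₁ (refl , refl))))
  unique _ _ _ (inj₂ (inj₁ p)) (inj₁ (inj₂ (refl , refl))) =
    cong (inj₂ ∘ inj₁) (pathOf-unique _ _ _ p (inj₁ (inj₂ (refl , refl))))
  unique _ _ _ (inj₂ (inj₁ p)) (inj₂ (inj₁ (refl , refl))) =
    cong (inj₂ ∘ inj₁) (pathOf-unique _ _ _ p (inj₂ (inj₁ (refl , refl))))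
  unique _ _ _ (inj₂ (inj₁ p)) (inj₂ (inj₂ (refl , refl))) =
    cong (inj₂ ∘ inj₁) (pathOf-unique _ _ _ p (inj₂ (inj₂ (refl , refl))))
  unique _ _ _ (inj₂ (inj₂ (x , 0F))) (inj₁ (inj₁ (refl , refl))) = refl
  unique _ _ _ (inj₂ (inj₂ (x , 0F))) (inj₁ (inj₂ (refl , refl))) = refl
  unique _ _ _ (inj₂ (inj₂ (x , 0F))) (inj₂ (inj₁ (refl , refl))) = refl
  unique _ _ _ (inj₂ (inj₂ (x , 0F))) (inj₂ (inj₂ (refl , refl))) = refl
  unique _ _ _ (inj₂ (inj₂ (x , 1F))) (inj₁ (inj₁ (refl , refl))) = refl
  unique _ _ _ (inj₂ (inj₂ (x , 1F))) (inj₁ (inj₂ (refl , refl))) = refl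
  unique _ _ _ (inj₂ (inj₂ (x , 1F))) (inj₂ (inj₁ (refl , refl))) = refl
  unique _ _ _ (inj₂ (inj₂ (x , 1F))) (inj₂ (inj₂ (refl , refl))) = refl

K-P₃Decomposition-+4 : ∀ {r} → P₃Decomposition (K r) → ∀ k → P₃Decomposition (K (k * 4 + r))
K-P₃Decomposition-+4 D zero = D
K-P₃Decomposition-+4 D (suc k) = transport (↔-sym +↔⊎) (extend (K-P₃Decomposition-+4 D k))

K-P₃Decomposition : ∀ n → n % 4 ≡ 0 ⊎ n % 4 ≡ 1 → P₃Decomposition (K n)
K-P₃Decomposition n n%4≡0⊎1 =
  subst (P₃Decomposition ∘ K) n≡ (K-P₃Decomposition-+4 (base n%4≡0⊎1) (n / 4))
  where
  n≡ : n / 4 * 4 + n % 4 ≡ n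
  n≡ = trans (+-comm (n / 4 * 4) (n % 4)) (sym (m≡m%n+[m/n]*n n 4))

  base : n % 4 ≡ 0 ⊎ n % 4 ≡ 1 → P₃Decomposition (K (n % 4))
  base (inj₁ n%4≡0) rewrite n%4≡0 = P₃Decomposition-subsingleton λ ()
  base (inj₂ n%4≡1) rewrite n%4≡1 = P₃Decomposition-subsingleton λ { 0F 0F → refl }

8∤4+k*8 : ∀ k → ¬ 8 ∣ 4 + k * 8
8∤4+k*8 k 8∣ with trans (sym ([m+kn]%n≡m%n 4 k 8)) (n∣m⇒m%n≡0 _ 8 8∣)
... | ()

6*[2+q*4]*[1+q*4]≡4+k*8 : ∀ q → 6 * ((2 + q * 4) * (1 + q * 4)) ≡ 4 + (12 * q * q + 9 * q + 1) * 8
6*[2+q*4]*[1+q*4]≡4+k*8 = solve-∀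

6*[3+q*4]*[2+q*4]≡4+k*8 : ∀ q → 6 * ((3 + q * 4) * (2 + q * 4)) ≡ 4 + (12 * q * q + 15 * q + 4) * 8
6*[3+q*4]*[2+q*4]≡4+k*8 = solve-∀

8∣6*[1+n]*n⇒[1+n]%4≡0⊎1 : ∀ n → 8 ∣ 6 * (suc n * n) → suc n % 4 ≡ 0 ⊎ suc n % 4 ≡ 1
8∣6*[1+n]*n⇒[1+n]%4≡0⊎1 n 8∣ with suc n % 4 | m%n<n (suc n) 4 | m≡m%n+[m/n]*n (suc n) 4
... | 0 | _ | _ = inj₁ refl
... | 1 | _ | _ = inj₂ refl
... | 2 | _ | 1+n≡ = ⊥-elim (8∤4+k*8 (12 * q * q + 9 * q + 1) (subst (8 ∣_) 6*[1+n]*n≡ 8∣))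
  where
  q = suc n / 4
  6*[1+n]*n≡ : 6 * (suc n * n) ≡ 4 + (12 * q * q + 9 * q + 1) * 8
  6*[1+n]*n≡ = trans (cong (λ t → 6 * (suc t * t)) (suc-injective 1+n≡)) (6*[2+q*4]*[1+q*4]≡4+k*8 q)
... | 3 | _ | 1+n≡ = ⊥-elim (8∤4+k*8 (12 * q * q + 15 * q + 4) (subst (8 ∣_) 6*[1+n]*n≡ 8∣))
  where
  q = suc n / 4
  6*[1+n]*n≡ : 6 * (suc n * n) ≡ 4 + (12 * q * q + 15 * q + 4) * 8
  6*[1+n]*n≡ = trans (cong (λ t → 6 * (suc t * t)) (suc-injective 1+n≡)) (6*[3+q*4]*[2+q*4]≡4+k*8 q)
... | suc (suc (suc (suc _))) | s≤s (s≤s (s≤s (s≤s ()))) | _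

C₃⊗K-C4Decomposition⇒n%4≡0⊎1 : ∀ n → C4Decomposition (C 3 ⊗ K n) → n % 4 ≡ 0 ⊎ n % 4 ≡ 1
C₃⊗K-C4Decomposition⇒n%4≡0⊎1 zero _ = inj₁ refl
C₃⊗K-C4Decomposition⇒n%4≡0⊎1 (suc n) D =
  8∣6*[1+n]*n⇒[1+n]%4≡0⊎1 n (divides (length (C4Decomposition.cycles D)) (sym 8*cycles≡darts))
  where
  8*cycles≡darts : length (C4Decomposition.cycles D) * 8 ≡ 6 * (suc n * n)
  8*cycles≡darts = C4Decomposition-darts (⊗-sym {C 3} {K (suc n)} (C-sym 3) ≢-sym) D
    (⊗-darts C₃-darts (K-darts n))

theorem3p3 : (n : ℕ) → 1 ≤ n →
    (C4Decomposition (C 3 ⊗ K n) ⇔ (n % 4 ≡ 0 ⊎ n % 4 ≡ 1))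
theorem3p3 n _ = mk⇔ (C₃⊗K-C4Decomposition⇒n%4≡0⊎1 n)
  (C₃⊗-C4Decomposition ≢-sym _≟_ ∘ K-P₃Decomposition n)
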